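{- Let $r_0=\max(2,D,2\|\mathcal{A}\|+1)$, let $r$ be an integer, $\phi$ an automorphism of $B_r$, and $v\in V(B_r)$ with $\rho(v)\le r-r_0$. Then for each secondary element $a\in\mathcal{A}$, the element $\phi(v+a)-\phi(v)$ is secondary as well.
   Context: Let $G$ be a free abelian group of finite rank $k\ge1$, identified with $\mathbb{Z}^k$, and $\mathcal{A}\subset G$ a finite generating set with $\mathcal{A}=-\mathcal{A}$, $0\notin\mathcal{A}$. $\Gamma=\mathrm{Cay}(G,\mathcal{A})$ has vertex set $G$ and edges $\{x,x+a\}$, $a\in\mathcal{A}$. $\rho(x)$ is the length of a shortest path in $\Gamma$ from $0$ to $x$, $\omega(x)$ the number of such shortest paths. $B_r$ is the subgraph of $\Gamma$ induced by $\{x:\rho(x)\le r\}$. An element $x\in\mathcal{A}$ is primary if $\rho(tx)=t$ and $\omega(tx)=1$ for all integers $t\ge0$, otherwise secondary. $D$ is a fixed positive integer such that every secondary $x\in\mathcal{A}$ satisfies $\rho(Dx)\ne D$ or $\omega(Dx)\ne1$. $\|x\|$ is the $\ell_\infty$-norm on $\mathbb{Z}^k$, $\|\mathcal{A}\|=\max_{x\in\mathcal{A}}\|x\|$. -}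

module Defs where

open import Data.Nat as ℕ using (ℕ; zero; suc; _⊔_; _<_)
open import Data.Integer as ℤ using (ℤ; +_; ∣_∣)
open import Data.Vec as Vec using (Vec; zipWith; replicate)
open import Data.Vec.Properties using (≡-dec)
open import Data.List as List using (List; []; _∷_; concatMap; filter; length; foldr)
open import Data.List.Membership.Propositional using (_∈_)
open import Data.Fin using (Fin)
open import Data.Product using (Σ; _×_)
open import Relation.Nullary using (¬_)
open import Relation.Binary.PropositionalEquality using (_≡_)

G : ℕ → Set
G k = Vec ℤ k

module _ {k : ℕ} where

  0G : G k
  0G = replicate k (+ 0)

  infixl 6 _+G_ _-G_
  _+G_ : G k → G k → G k
  _+G_ = zipWith ℤ._+_

  -G_ : G k → G k
  -G_ = Vec.map (λ c → ℤ.- c)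

  _-G_ : G k → G k → G k
  x -G y = x +G (-G y)

  _·G_ : ℕ → G k → G k
  t ·G x = Vec.map (λ c → + t ℤ.* c) x

  _≟G_ : (x y : G k) → Relation.Nullary.Dec (x ≡ y)
  _≟G_ = ≡-dec ℤ._≟_

  sumG : List (G k) → G k
  sumG = foldr _+G_ 0G

  ‖_‖ : G k → ℕ
  ‖ x ‖ = Vec.foldr _ (λ c m → ∣ c ∣ ⊔ m) 0 x

  lincomb : (A : List (G k)) → (Fin (length A) → ℤ) → G k
  lincomb [] c = 0G
  lincomb (a ∷ A) c = (Vec.map (c Fin.zero ℤ.*_) a) +G lincomb A (λ i → c (Fin.suc i))
    where import Data.Fin as Fin

  module Cayley (𝒜 : List (G k)) where

    -- All words of length n over the (duplicate-free) generating list 𝒜.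
    -- A word a₁…aₙ corresponds bijectively to the walk
    -- 0, a₁, a₁+a₂, …, a₁+…+aₙ in Cay(G,𝒜) starting at 0.
    words : ℕ → List (List (G k))
    words zero = [] ∷ []
    words (suc n) = concatMap (λ a → List.map (a ∷_) (words n)) 𝒜

    pathCount : ℕ → G k → ℕ
    pathCount n x = length (filter (λ w → sumG w ≟G x) (words n))

    Dist : G k → ℕ → Set
    Dist x n = (0 < pathCount n x) × (∀ m → m < n → pathCount m x ≡ 0)

    GeodUnique : G k → ℕ → Set
    GeodUnique x n = Dist x n × (pathCount n x ≡ 1)

    Primary : G k → Set
    Primary x = ∀ (t : ℕ) → GeodUnique (t ·G x) t

    Secondary : G k → Set
    Secondary x = ¬ Primary x

    InBall : ℤ → G k → Set
    InBall r x = Σ ℕ (λ n → Dist x n × (+ n ℤ.≤ r))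

    Adj : G k → G k → Set
    Adj x y = (y -G x) ∈ 𝒜

    -- φ restricted to V(B_r) is an automorphism of B_r (values of φ
    -- outside V(B_r) are irrelevant); ψ is its inverse on V(B_r).
    record IsBallAut (r : ℤ) (φ : G k → G k) : Set where
      field
        ψ        : G k → G k
        φ-ball   : ∀ x → InBall r x → InBall r (φ x)
        ψ-ball   : ∀ x → InBall r x → InBall r (ψ x)
        ψφ       : ∀ x → InBall r x → ψ (φ x) ≡ x
        φψ       : ∀ x → InBall r x → φ (ψ x) ≡ x
        adj→     : ∀ x y → InBall r x → InBall r y → Adj x y → Adj (φ x) (φ y)
        adj←     : ∀ x y → InBall r x → InBall r y → Adj (φ x) (φ y) → Adj x y

  ‖_‖L : List (G k) → ℕ
  ‖ A ‖L = foldr (λ a m → ‖ a ‖ ⊔ m) 0 A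

module Submission where

-- Let b = φ(v+a) − φ(v) ∈ 𝒜 and suppose b is primary, so the word bᴰ is
-- the unique geodesic for D·b.  The argument has three ingredients.
--  * Interior points (ρ(ψ u) < r, ψ = φ⁻¹) have all their neighbours in
--    B_r, by a pigeonhole argument on the injective neighbour map of φ;
--    hence the straight walk bᴰ from φ(v) stays in B_r.
--  * Pulling a unique geodesic word back along ψ gives a unique geodesic
--    word, as long as all competing walks from v stay inside B_r; this
--    holds since ρ(v) + D ≤ r.  The pull-back C of bᴰ starts with a.
--  * A unique geodesic word a·c₁⋯cₙ equals its rotation c₁⋯cₙ·a, so it
--    is aⁿ⁺¹.  Hence C = aᴰ, so D·a has a unique geodesic of length D,
--    contradicting the choice of D for the secondary element a.

open import Defs
open import Data.Nat as ℕ using (ℕ; zero; suc; _<_; _≤_; z≤n; s≤s; _⊔_; _*_; _+_)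
import Data.Nat.Properties as ℕP
open import Data.Integer as ℤ using (ℤ; +_)
import Data.Integer.Properties as ℤP
open import Data.Vec using ([]; _∷_)
import Data.Vec.Relation.Binary.Pointwise.Inductive as Pointwise
open import Data.List as List
  using (List; []; _∷_; _++_; length; filter; replicate; cartesianProductWith)
import Data.List.Properties as LP
open import Data.List.Membership.Propositional using (_∈_; _∉_)
open import Data.List.Membership.Propositional.Properties
  using (∈-map⁻; ∈-filter⁺; ∈-filter⁻; ∈-cartesianProductWith⁺; ∈-cartesianProductWith⁻)
open import Data.List.Membership.DecPropositional using (_∈?_)
open import Data.List.Relation.Binary.Subset.Propositional using (_⊆_)
open import Data.List.Relation.Unary.Any using (here; there; index; _─_)
open import Data.List.Relation.Unary.All as All using (All; []; _∷_)
open import Data.List.Relation.Unary.All.Properties using (¬Any⇒All¬; replicate⁺; ++⁺)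
open import Data.List.Relation.Unary.AllPairs using ([]; _∷_)
open import Data.List.Relation.Unary.Unique.Propositional using (Unique)
import Data.List.Relation.Unary.Unique.Propositional.Properties as Unique
open import Data.Fin using (Fin)
open import Data.Product using (Σ; ∃; _×_; _,_)
open import Data.Empty using (⊥-elim)
open import Relation.Nullary using (¬_; yes; no)
open import Relation.Binary.Definitions using (DecidableEquality)
open import Relation.Binary.PropositionalEquality

private variable k : ℕ

+G-assoc : (x y z : G k) → (x +G y) +G z ≡ x +G (y +G z)
+G-assoc x y z = Pointwise.Pointwise-≡⇒≡ (Pointwise.zipWith-assoc ℤP.+-assoc x y z)

+G-comm : (x y : G k) → x +G y ≡ y +G x
+G-comm x y = Pointwise.Pointwise-≡⇒≡ (Pointwise.zipWith-comm ℤP.+-comm x y)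

+G-identityʳ : (x : G k) → x +G 0G ≡ x
+G-identityʳ x = Pointwise.Pointwise-≡⇒≡ (Pointwise.zipWith-identityʳ ℤP.+-identityʳ x)

+G-inverseˡ : (x : G k) → (-G x) +G x ≡ 0G
+G-inverseˡ [] = refl
+G-inverseˡ (c ∷ x) = cong₂ _∷_ (ℤP.+-inverseˡ c) (+G-inverseˡ x)

+G-sub : (p x : G k) → (p +G x) -G p ≡ x
+G-sub p x = begin
  (p +G x) -G p       ≡⟨ cong (_-G p) (+G-comm p x) ⟩
  (x +G p) -G p       ≡⟨ +G-assoc x p (-G p) ⟩
  x +G (p -G p)       ≡⟨ cong (x +G_) (+G-comm p (-G p)) ⟩
  x +G ((-G p) +G p)  ≡⟨ cong (x +G_) (+G-inverseˡ p) ⟩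
  x +G 0G             ≡⟨ +G-identityʳ x ⟩
  x                   ∎
  where open ≡-Reasoning

sub-+G : (p q : G k) → p +G (q -G p) ≡ q
sub-+G p q = begin
  p +G (q -G p)       ≡⟨ +G-comm p (q -G p) ⟩
  (q +G (-G p)) +G p  ≡⟨ +G-assoc q (-G p) p ⟩
  q +G ((-G p) +G p)  ≡⟨ cong (q +G_) (+G-inverseˡ p) ⟩
  q +G 0G             ≡⟨ +G-identityʳ q ⟩
  q                   ∎
  where open ≡-Reasoning

+G-cancelˡ : (p x y : G k) → p +G x ≡ p +G y → x ≡ y
+G-cancelˡ p x y eq = trans (sym (+G-sub p x)) (trans (cong (_-G p) eq) (+G-sub p y))

-G-cancelʳ : (p x y : G k) → x -G p ≡ y -G p → x ≡ y
-G-cancelʳ p x y eq = trans (sym (sub-+G p x)) (trans (cong (p +G_) eq) (sub-+G p y))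

sumG-snoc : (a : G k) (cs : List (G k)) → sumG (cs ++ a ∷ []) ≡ a +G sumG cs
sumG-snoc a [] = refl
sumG-snoc a (c ∷ cs) = begin
  c +G sumG (cs ++ a ∷ [])  ≡⟨ cong (c +G_) (sumG-snoc a cs) ⟩
  c +G (a +G sumG cs)       ≡⟨ sym (+G-assoc c a (sumG cs)) ⟩
  (c +G a) +G sumG cs       ≡⟨ cong (_+G sumG cs) (+G-comm c a) ⟩
  (a +G c) +G sumG cs       ≡⟨ +G-assoc a c (sumG cs) ⟩
  a +G (c +G sumG cs)       ∎
  where open ≡-Reasoning

sumG-replicate : (t : ℕ) (b : G k) → sumG (replicate t b) ≡ t ·G b
sumG-replicate zero [] = refl
sumG-replicate zero (c ∷ b) = cong₂ _∷_ (sym (ℤP.*-zeroˡ c)) (sumG-replicate zero b)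
sumG-replicate (suc t) b = trans (cong (b +G_) (sumG-replicate t b)) (step b)
  where
  step : ∀ {n} (b : G n) → b +G (t ·G b) ≡ suc t ·G b
  step [] = refl
  step (c ∷ b) = cong₂ _∷_ (sym (ℤP.suc-* (+ t) c)) (step b)

-- Finite combinatorics on lists.

module _ {A : Set} where

  ∈-─ : ∀ {x z} {ys : List A} (p : x ∈ ys) → z ∈ ys → x ≢ z → z ∈ (ys ─ p)
  ∈-─ (here refl) (here refl) x≢z = ⊥-elim (x≢z refl)
  ∈-─ (here _) (there z∈) _ = z∈
  ∈-─ (there _) (here refl) _ = here refl
  ∈-─ (there p) (there z∈) x≢z = there (∈-─ p z∈ x≢z)

  unique-⊆-length : {xs ys : List A} → Unique xs → xs ⊆ ys → length xs ≤ length ys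
  unique-⊆-length {[]} _ _ = z≤n
  unique-⊆-length {x ∷ xs} {ys} (x∉xs ∷ u) xs⊆ys =
    subst (suc (length xs) ≤_) (sym (LP.length-removeAt′ ys (index x∈ys)))
      (s≤s (unique-⊆-length u λ z∈ → ∈-─ x∈ys (xs⊆ys (there z∈)) (All.lookup x∉xs z∈)))
    where x∈ys = xs⊆ys (here refl)

  map-unique : (h : A → A) {L : List A} → Unique L →
               (∀ {y y'} → y ∈ L → y' ∈ L → h y ≡ h y' → y ≡ y') → Unique (List.map h L)
  map-unique h {[]} _ _ = []
  map-unique h {y ∷ L} (y∉L ∷ u) inj =
    All.tabulate fresh ∷ map-unique h u (λ p q → inj (there p) (there q))
    where
    fresh : ∀ {w} → w ∈ List.map h L → h y ≢ w
    fresh w∈ eq with z , z∈ , refl ← ∈-map⁻ h w∈ = All.lookup y∉L z∈ (inj (here refl) (there z∈) eq)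

  injective-onto : DecidableEquality A → (h : A → A) {L : List A} → Unique L →
                   (∀ {y} → y ∈ L → h y ∈ L) →
                   (∀ {y y'} → y ∈ L → y' ∈ L → h y ≡ h y' → y ≡ y') →
                   ∀ {x} → x ∈ L → ∃ λ y → y ∈ L × x ≡ h y
  injective-onto _≟_ h {L} u into inj {x} x∈L with _∈?_ _≟_ x (List.map h L)
  ... | yes x∈hL = ∈-map⁻ h x∈hL
  ... | no x∉hL = ⊥-elim (ℕP.<-irrefl (LP.length-map h L) (unique-⊆-length hL' hL'⊆L))
    where
    hL' : Unique (x ∷ List.map h L)
    hL' = ¬Any⇒All¬ _ x∉hL ∷ map-unique h u inj
    hL'⊆L : x ∷ List.map h L ⊆ L
    hL'⊆L (here refl) = x∈L
    hL'⊆L (there w∈) with y , y∈ , refl ← ∈-map⁻ h w∈ = into y∈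

  rotation-invariant : (a : A) (cs : List A) → cs ++ a ∷ [] ≡ a ∷ cs →
                       a ∷ cs ≡ replicate (suc (length cs)) a
  rotation-invariant a [] _ = refl
  rotation-invariant a (c ∷ cs) eq with refl , eq' ← LP.∷-injective eq =
    cong (a ∷_) (rotation-invariant a cs eq')

  ∈⇒length>0 : ∀ {x} {l : List A} → x ∈ l → 0 < length l
  ∈⇒length>0 {l = _ ∷ _} _ = s≤s z≤n

  length≡1⇒equal : {l : List A} → length l ≡ 1 → ∀ {a b} → a ∈ l → b ∈ l → a ≡ b
  length≡1⇒equal {_ ∷ []} _ (here p) (here q) = trans p (sym q)

  unique-singleton : {l : List A} → Unique l → ∀ {c} → c ∈ l → (∀ {y} → y ∈ l → y ≡ c) → length l ≡ 1
  unique-singleton {_ ∷ []} _ _ _ = refl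
  unique-singleton {_ ∷ _ ∷ _} ((y≢z ∷ _) ∷ _) _ all =
    ⊥-elim (y≢z (trans (all (here refl)) (sym (all (there (here refl))))))

least-positive : (f : ℕ → ℕ) (n : ℕ) → 0 < f n →
                 ∃ λ m → 0 < f m × m ≤ n × (∀ j → j < m → f j ≡ 0)
least-positive f zero pos = 0 , pos , z≤n , λ _ ()
least-positive f (suc n) pos with f 0 ℕ.≟ 0
... | no f0≢0 = 0 , ℕP.n≢0⇒n>0 f0≢0 , z≤n , λ _ ()
... | yes f0≡0 with m , pos' , m≤n , below ← least-positive (λ j → f (suc j)) n pos =
  suc m , pos' , s≤s m≤n , zeros
  where
  zeros : ∀ j → j < suc m → f j ≡ 0
  zeros zero _ = f0≡0
  zeros (suc j) (s≤s j<m) = below j j<m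

-- Words, walk counts and geodesics in Cay(ℤ^k, 𝒜).

module Geodesics {k : ℕ} (𝒜 : List (G k)) (𝒜-unique : Unique 𝒜) where
  open Cayley 𝒜

  IsWord : List (G k) → Set
  IsWord = All (_∈ 𝒜)

  Reach : G k → ℕ → Set
  Reach x n = ∃ λ w → IsWord w × length w ≡ n × sumG w ≡ x

  reach-step : ∀ {p n x} → Reach p n → x ∈ 𝒜 → Reach (p +G x) (suc n)
  reach-step {p} {x = x} (w , w-word , refl , refl) x∈ = x ∷ w , x∈ ∷ w-word , refl , +G-comm x p

  words-power : ∀ n → words (suc n) ≡ cartesianProductWith _∷_ 𝒜 (words n)
  words-power n = go 𝒜
    where
    go : ∀ L → List.concatMap (λ a → List.map (a ∷_) (words n)) L ≡ cartesianProductWith _∷_ L (words n)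
    go [] = refl
    go (a ∷ L) = cong (List.map (a ∷_) (words n) ++_) (go L)

  words-unique : ∀ n → Unique (words n)
  words-unique zero = [] ∷ []
  words-unique (suc n) rewrite words-power n =
    Unique.cartesianProductWith⁺ _∷_ LP.∷-injective 𝒜-unique (words-unique n)

  ∈-words⁺ : ∀ {w} → IsWord w → w ∈ words (length w)
  ∈-words⁺ [] = here refl
  ∈-words⁺ {x ∷ w} (x∈ ∷ w-word) rewrite words-power (length w) =
    ∈-cartesianProductWith⁺ _∷_ x∈ (∈-words⁺ w-word)

  ∈-words⁻ : ∀ n {w} → w ∈ words n → IsWord w × length w ≡ n
  ∈-words⁻ zero (here refl) = [] , refl
  ∈-words⁻ (suc n) w∈ rewrite words-power n
    with x , v , x∈ , v∈ , refl ← ∈-cartesianProductWith⁻ _∷_ 𝒜 (words n) w∈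
    with v-word , refl ← ∈-words⁻ n v∈ = x∈ ∷ v-word , refl

  walksTo : G k → ℕ → List (List (G k))
  walksTo x n = filter (λ w → sumG w ≟G x) (words n)

  ∈-walksTo⁺ : ∀ {x w} → IsWord w → sumG w ≡ x → w ∈ walksTo x (length w)
  ∈-walksTo⁺ w-word sum = ∈-filter⁺ (λ w → sumG w ≟G _) (∈-words⁺ w-word) sum

  reach⇒pathCount>0 : ∀ {x n} → Reach x n → 0 < pathCount n x
  reach⇒pathCount>0 (w , w-word , refl , sum) = ∈⇒length>0 (∈-walksTo⁺ w-word sum)

  pathCount>0⇒reach : ∀ {x n} → 0 < pathCount n x → Reach x n
  pathCount>0⇒reach {x} {n} pos with walksTo x n in eq
  ... | w ∷ _ with w∈ , sum ← ∈-filter⁻ (λ w → sumG w ≟G x) {xs = words n} (subst (w ∈_) (sym eq) (here refl))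
      with w-word , len ← ∈-words⁻ n w∈ = w , w-word , len , sum

  reach⇒dist : ∀ {x n} → Reach x n → ∃ λ m → Dist x m × m ≤ n
  reach⇒dist {x} {n} rx with m , pos , m≤n , below ← least-positive (λ j → pathCount j x) n (reach⇒pathCount>0 rx) =
    m , (pos , below) , m≤n

  IsUniqueGeodesic : List (G k) → Set
  IsUniqueGeodesic c = IsWord c × (∀ w → IsWord w → length w ≤ length c → sumG w ≡ sumG c → w ≡ c)

  geodUnique⇒uniqueGeodesic : ∀ {c} → IsWord c → GeodUnique (sumG c) (length c) → IsUniqueGeodesic c
  geodUnique⇒uniqueGeodesic {c} c-word ((_ , below) , one) = c-word , same
    where
    same : ∀ w → IsWord w → length w ≤ length c → sumG w ≡ sumG c → w ≡ c
    same w w-word w≤c sum = length≡1⇒equal one (subst (λ n → w ∈ walksTo _ n) len (∈-walksTo⁺ w-word sum))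
                                                (∈-walksTo⁺ c-word refl)
      where
      len : length w ≡ length c
      len = ℕP.≤∧≮⇒≡ w≤c λ w<c →
        ℕP.<-irrefl (sym (below _ w<c)) (reach⇒pathCount>0 (w , w-word , refl , sum))

  uniqueGeodesic⇒geodUnique : ∀ {c} → IsUniqueGeodesic c → GeodUnique (sumG c) (length c)
  uniqueGeodesic⇒geodUnique {c} (c-word , same) = (reach⇒pathCount>0 (c , c-word , refl , refl) , below) , one
    where
    below : ∀ m → m < length c → pathCount m (sumG c) ≡ 0
    below m m<c = ℕP.n≤0⇒n≡0 (ℕP.≮⇒≥ λ pos →
      let w , w-word , len , sum = pathCount>0⇒reach pos
      in ℕP.<-irrefl (trans (sym len) (cong length (same w w-word (subst (_≤ _) (sym len) (ℕP.<⇒≤ m<c)) sum))) m<c)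
    one : pathCount (length c) (sumG c) ≡ 1
    one = unique-singleton (Unique.filter⁺ (λ w → sumG w ≟G sumG c) (words-unique (length c)))
            (∈-walksTo⁺ c-word refl)
            λ w∈ → let w∈' , sum = ∈-filter⁻ (λ w → sumG w ≟G sumG c) {xs = words (length c)} w∈
                       w-word , len = ∈-words⁻ (length c) w∈'
                   in same _ w-word (ℕP.≤-reflexive len) sum

  primary-power : ∀ {b} → b ∈ 𝒜 → Primary b → ∀ t → IsUniqueGeodesic (replicate t b)
  primary-power {b} b∈ prim t = geodUnique⇒uniqueGeodesic (replicate⁺ t b∈)
    (subst₂ GeodUnique (sym (sumG-replicate t b)) (sym (LP.length-replicate t)) (prim t))

  -- A unique geodesic starting with a is a power of a: its rotation
  -- c₁⋯cₙ·a has the same length and sum.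
  uniqueGeodesic-power : ∀ {a cs} → IsUniqueGeodesic (a ∷ cs) → a ∷ cs ≡ replicate (suc (length cs)) a
  uniqueGeodesic-power {a} {cs} (a∈ ∷ cs-word , same) = rotation-invariant a cs
    (same (cs ++ a ∷ []) (++⁺ cs-word (a∈ ∷ [])) (ℕP.≤-reflexive (trans (LP.length-++ cs) (ℕP.+-comm (length cs) 1))) (sumG-snoc a cs))

  -- Walks inside the ball B_r and their images under automorphisms.

  module Ball (r : ℤ) where

    within : ∀ {m n} → m ≤ n → + n ℤ.≤ r → + m ℤ.≤ r
    within m≤n = ℤP.≤-trans (ℤ.+≤+ m≤n)

    reach⇒inBall : ∀ {x n} → Reach x n → + n ℤ.≤ r → InBall r x
    reach⇒inBall rx n≤r with m , dist , m≤n ← reach⇒dist rx = m , dist , within m≤n n≤r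

    WalkIn : G k → List (G k) → Set
    WalkIn p [] = InBall r p
    WalkIn p (x ∷ ws) = InBall r p × x ∈ 𝒜 × WalkIn (p +G x) ws

    walk-start : ∀ {p} ws → WalkIn p ws → InBall r p
    walk-start [] inB = inB
    walk-start (_ ∷ _) (inB , _) = inB

    walk-word : ∀ {p} ws → WalkIn p ws → IsWord ws
    walk-word [] _ = []
    walk-word (_ ∷ ws) (_ , x∈ , walk) = x∈ ∷ walk-word ws walk

    walk-end : ∀ {p} ws → WalkIn p ws → InBall r (p +G sumG ws)
    walk-end {p} [] inB = subst (InBall r) (sym (+G-identityʳ p)) inB
    walk-end {p} (x ∷ ws) (_ , _ , walk) = subst (InBall r) (+G-assoc p x (sumG ws)) (walk-end ws walk)

    walk-near-centre : ∀ {p n} → Reach p n → ∀ ws → IsWord ws → + (n + length ws) ℤ.≤ r → WalkIn p ws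
    walk-near-centre {n = n} rp [] [] le = reach⇒inBall rp (subst (λ m → + m ℤ.≤ r) (ℕP.+-identityʳ n) le)
    walk-near-centre {n = n} rp (x ∷ ws) (x∈ ∷ ws-word) le =
      reach⇒inBall rp (within (ℕP.m≤m+n n _) le) , x∈ ,
      walk-near-centre (reach-step rp x∈) ws ws-word (subst (λ m → + m ℤ.≤ r) (ℕP.+-suc n (length ws)) le)

    inverse : ∀ {φ} (A : IsBallAut r φ) → IsBallAut r (IsBallAut.ψ A)
    inverse {φ} A = record
      { ψ = φ ; φ-ball = ψ-ball ; ψ-ball = φ-ball ; ψφ = φψ ; φψ = ψφ
      ; adj→ = λ x y x∈ y∈ adj → adj← (ψ x) (ψ y) (ψ-ball x x∈) (ψ-ball y y∈)
                  (subst₂ Adj (sym (φψ x x∈)) (sym (φψ y y∈)) adj)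
      ; adj← = λ x y x∈ y∈ adj → subst₂ Adj (φψ x x∈) (φψ y y∈) (adj→ (ψ x) (ψ y) (ψ-ball x x∈) (ψ-ball y y∈) adj)
      }
      where open IsBallAut A

    imageWord : (G k → G k) → G k → List (G k) → List (G k)
    imageWord f p [] = []
    imageWord f p (x ∷ ws) = (f (p +G x) -G f p) ∷ imageWord f (p +G x) ws

    imageWord-length : ∀ f p ws → length (imageWord f p ws) ≡ length ws
    imageWord-length f p [] = refl
    imageWord-length f p (x ∷ ws) = cong suc (imageWord-length f (p +G x) ws)

    imageWord-end : ∀ f p ws → f p +G sumG (imageWord f p ws) ≡ f (p +G sumG ws)
    imageWord-end f p [] = trans (+G-identityʳ (f p)) (cong f (sym (+G-identityʳ p)))
    imageWord-end f p (x ∷ ws) = begin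
      f p +G ((f (p +G x) -G f p) +G sumG (imageWord f (p +G x) ws))
        ≡⟨ sym (+G-assoc (f p) _ _) ⟩
      (f p +G (f (p +G x) -G f p)) +G sumG (imageWord f (p +G x) ws)
        ≡⟨ cong (_+G sumG (imageWord f (p +G x) ws)) (sub-+G (f p) (f (p +G x))) ⟩
      f (p +G x) +G sumG (imageWord f (p +G x) ws)
        ≡⟨ imageWord-end f (p +G x) ws ⟩
      f ((p +G x) +G sumG ws)
        ≡⟨ cong f (+G-assoc p x (sumG ws)) ⟩
      f (p +G (x +G sumG ws)) ∎
      where open ≡-Reasoning

    module Automorphism {φ} (A : IsBallAut r φ) where
      open IsBallAut A

      step∈𝒜 : ∀ {p x} → InBall r p → InBall r (p +G x) → x ∈ 𝒜 → (φ (p +G x) -G φ p) ∈ 𝒜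
      step∈𝒜 {p} {x} p∈ px∈ x∈ = adj→ p (p +G x) p∈ px∈ (subst (_∈ 𝒜) (sym (+G-sub p x)) x∈)

      image-walk : ∀ {p} ws → WalkIn p ws → WalkIn (φ p) (imageWord φ p ws)
      image-walk [] p∈ = φ-ball _ p∈
      image-walk {p} (x ∷ ws) (p∈ , x∈ , walk) =
        φ-ball p p∈ , step∈𝒜 p∈ (walk-start ws walk) x∈ ,
        subst (λ q → WalkIn q (imageWord φ (p +G x) ws)) (sym (sub-+G (φ p) (φ (p +G x)))) (image-walk ws walk)

      imageWord-inverse : ∀ {p} ws → WalkIn p ws → ∀ q → q ≡ φ p → imageWord ψ q (imageWord φ p ws) ≡ ws
      imageWord-inverse [] _ q _ = refl
      imageWord-inverse {p} (x ∷ ws) (p∈ , _ , walk) q refl =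
        cong₂ _∷_ first (imageWord-inverse ws walk _ (sub-+G (φ p) (φ (p +G x))))
        where
        first : ψ (φ p +G (φ (p +G x) -G φ p)) -G ψ (φ p) ≡ x
        first = begin
          ψ (φ p +G (φ (p +G x) -G φ p)) -G ψ (φ p) ≡⟨ cong (λ y → ψ y -G ψ (φ p)) (sub-+G (φ p) (φ (p +G x))) ⟩
          ψ (φ (p +G x)) -G ψ (φ p)                ≡⟨ cong₂ _-G_ (ψφ _ (walk-start ws walk)) (ψφ p p∈) ⟩
          (p +G x) -G p                            ≡⟨ +G-sub p x ⟩
          x                                        ∎
          where open ≡-Reasoning

      -- Interior points: if ρ(ψ u) < r then every neighbour of u lies in
      -- B_r, since φ maps the |𝒜| neighbours of ψ u injectively to
      -- neighbours of u.
      interior-neighbours : ∀ {u n} → InBall r u → Reach (ψ u) n → + suc n ℤ.≤ r →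
                            ∀ {x} → x ∈ 𝒜 → InBall r (u +G x)
      interior-neighbours {u} {n} u∈ reach le {x} x∈ =
        let y , y∈ , x≡step = injective-onto _≟G_ step 𝒜-unique step∈ step-injective x∈
        in subst (InBall r) (trans (sym (sub-+G u (φ (p +G y)))) (cong (u +G_) (sym x≡step)))
                 (φ-ball _ (neighbour∈ y∈))
        where
        p = ψ u
        p∈ : InBall r p
        p∈ = ψ-ball u u∈
        neighbour∈ : ∀ {y} → y ∈ 𝒜 → InBall r (p +G y)
        neighbour∈ y∈ = reach⇒inBall (reach-step reach y∈) le
        step : G k → G k
        step y = φ (p +G y) -G u
        step∈ : ∀ {y} → y ∈ 𝒜 → step y ∈ 𝒜
        step∈ {y} y∈ = subst (λ q → (φ (p +G y) -G q) ∈ 𝒜) (φψ u u∈) (step∈𝒜 p∈ (neighbour∈ y∈) y∈)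
        step-injective : ∀ {y y'} → y ∈ 𝒜 → y' ∈ 𝒜 → step y ≡ step y' → y ≡ y'
        step-injective {y} {y'} y∈ y'∈ eq = +G-cancelˡ p y y'
          (trans (sym (ψφ _ (neighbour∈ y∈))) (trans (cong ψ (-G-cancelʳ u _ _ eq)) (ψφ _ (neighbour∈ y'∈))))

      walk-near-interior : ∀ {u n} → InBall r u → Reach (ψ u) n →
                           ∀ ws → IsWord ws → + (n + length ws) ℤ.≤ r → WalkIn u ws
      walk-near-interior u∈ _ [] _ _ = u∈
      walk-near-interior {u} {n} u∈ reach (x ∷ ws) (x∈ ∷ ws-word) le =
        u∈ , x∈ , walk-near-interior ux∈ reach' ws ws-word (subst (λ m → + m ℤ.≤ r) (ℕP.+-suc n (length ws)) le)
        where
        ux∈ : InBall r (u +G x)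
        ux∈ = interior-neighbours u∈ reach
                (within (ℕP.m<m+n n (s≤s z≤n)) le) x∈
        reach' : Reach (ψ (u +G x)) (suc n)
        reach' = subst (λ q → Reach q (suc n)) (sub-+G (ψ u) (ψ (u +G x)))
                   (reach-step reach (IsBallAut.adj→ (inverse A) u (u +G x) u∈ ux∈ (subst (_∈ 𝒜) (sym (+G-sub u x)) x∈)))

    pullback-uniqueGeodesic : ∀ {φ} (A : IsBallAut r φ) {v n} → Reach v n → ∀ B →
                              WalkIn (φ v) B → IsUniqueGeodesic B → + (n + length B) ℤ.≤ r →
                              IsUniqueGeodesic (imageWord (IsBallAut.ψ A) (φ v) B)
    pullback-uniqueGeodesic {φ} A {v} {n} rv B B-walk (_ , B-same) le =
      walk-word C (Automorphism.image-walk (inverse A) B B-walk) , same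
      where
      open IsBallAut A
      C = imageWord ψ (φ v) B
      v∈ : InBall r v
      v∈ = reach⇒inBall rv (within (ℕP.m≤m+n n _) le)
      same : ∀ w → IsWord w → length w ≤ length C → sumG w ≡ sumG C → w ≡ C
      same w w-word w≤C sum = begin
        w                                  ≡⟨ sym (Automorphism.imageWord-inverse A w w-walk (φ v) refl) ⟩
        imageWord ψ (φ v) (imageWord φ v w) ≡⟨ cong (imageWord ψ (φ v)) image≡B ⟩
        C                                  ∎
        where
        open ≡-Reasoning
        w≤B : length w ≤ length B
        w≤B = subst (length w ≤_) (imageWord-length ψ (φ v) B) w≤C
        w-walk : WalkIn v w
        w-walk = walk-near-centre rv w w-word (within (ℕP.+-monoʳ-≤ n w≤B) le)
        image-end : φ v +G sumG (imageWord φ v w) ≡ φ v +G sumG B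
        image-end = begin
          φ v +G sumG (imageWord φ v w) ≡⟨ imageWord-end φ v w ⟩
          φ (v +G sumG w)               ≡⟨ cong (λ q → φ (q +G sumG w)) (sym (ψφ v v∈)) ⟩
          φ (ψ (φ v) +G sumG w)         ≡⟨ cong (λ s → φ (ψ (φ v) +G s)) sum ⟩
          φ (ψ (φ v) +G sumG C)         ≡⟨ cong φ (imageWord-end ψ (φ v) B) ⟩
          φ (ψ (φ v +G sumG B))         ≡⟨ φψ _ (walk-end B B-walk) ⟩
          φ v +G sumG B                 ∎
        image≡B : imageWord φ v w ≡ B
        image≡B = B-same _ (walk-word _ (Automorphism.image-walk A w w-walk))
                    (subst (_≤ length B) (sym (imageWord-length φ v w)) w≤B)
                    (+G-cancelˡ (φ v) _ _ image-end)

    secondary-step : ∀ {φ} (A : IsBallAut r φ) (D : ℕ) → 1 ≤ D →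
                     (∀ x → x ∈ 𝒜 → Secondary x → ¬ GeodUnique (D ·G x) D) →
                     ∀ {v n} → Reach v n → + (n + D) ℤ.≤ r →
                     ∀ {a} → a ∈ 𝒜 → Secondary a → Secondary (φ (v +G a) -G φ v)
    secondary-step {φ} A (suc D') (s≤s z≤n) choiceD {v} {n} rv le {a} a∈ a-secondary b-primary =
      choiceD a a∈ a-secondary
        (subst₂ GeodUnique (trans (cong sumG C≡aᴰ) (sumG-replicate D a)) (trans (cong length C≡aᴰ) (LP.length-replicate D))
                 (uniqueGeodesic⇒geodUnique C-geodesic))
      where
      open IsBallAut A
      D = suc D'
      b = φ (v +G a) -G φ v
      v∈ : InBall r v
      v∈ = reach⇒inBall rv (within (ℕP.m≤m+n n D) le)
      va∈ : InBall r (v +G a)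
      va∈ = reach⇒inBall (reach-step rv a∈) (within (ℕP.m<m+n n (s≤s z≤n)) le)
      b∈ : b ∈ 𝒜
      b∈ = Automorphism.step∈𝒜 A v∈ va∈ a∈
      room : + (n + length (replicate D b)) ℤ.≤ r
      room = subst (λ m → + (n + m) ℤ.≤ r) (sym (LP.length-replicate D)) le
      reach-ψφv : Reach (ψ (φ v)) n
      reach-ψφv = subst (λ q → Reach q n) (sym (ψφ v v∈)) rv
      bᴰ-walk : WalkIn (φ v) (replicate D b)
      bᴰ-walk = Automorphism.walk-near-interior A (φ-ball v v∈) reach-ψφv (replicate D b)
                  (replicate⁺ D b∈) room
      C = imageWord ψ (φ v) (replicate D b)
      C-geodesic : IsUniqueGeodesic C
      C-geodesic = pullback-uniqueGeodesic A rv (replicate D b) bᴰ-walk (primary-power b∈ b-primary D) room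
      first : ψ (φ v +G b) -G ψ (φ v) ≡ a
      first = begin
        ψ (φ v +G b) -G ψ (φ v) ≡⟨ cong (λ y → ψ y -G ψ (φ v)) (sub-+G (φ v) (φ (v +G a))) ⟩
        ψ (φ (v +G a)) -G ψ (φ v) ≡⟨ cong₂ _-G_ (ψφ _ va∈) (ψφ v v∈) ⟩
        (v +G a) -G v           ≡⟨ +G-sub v a ⟩
        a                       ∎
        where open ≡-Reasoning
      cs = imageWord ψ (φ v +G b) (replicate D' b)
      C≡a∷cs : C ≡ a ∷ cs
      C≡a∷cs = cong (_∷ cs) first
      C≡aᴰ : C ≡ replicate D a
      C≡aᴰ = begin
        C                                 ≡⟨ C≡a∷cs ⟩
        a ∷ cs                            ≡⟨ uniqueGeodesic-power (subst IsUniqueGeodesic C≡a∷cs C-geodesic) ⟩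
        replicate (suc (length cs)) a     ≡⟨ cong (λ m → replicate (suc m) a) cs-length ⟩
        replicate D a                     ∎
        where
        open ≡-Reasoning
        cs-length : length cs ≡ D'
        cs-length = trans (imageWord-length ψ (φ v +G b) (replicate D' b)) (LP.length-replicate D')

depth-bound : (r : ℤ) (n D r₀ : ℕ) → D ≤ r₀ → + n ℤ.≤ r ℤ.- + r₀ → + (n + D) ℤ.≤ r
depth-bound r n D r₀ D≤r₀ le = subst (+ (n + D) ℤ.≤_) cancel (ℤP.+-mono-≤ le (ℤ.+≤+ D≤r₀))
  where
  cancel : (r ℤ.- + r₀) ℤ.+ + r₀ ≡ r
  cancel = trans (ℤP.+-assoc r (ℤ.- + r₀) (+ r₀))
                 (trans (cong (λ q → r ℤ.+ q) (ℤP.+-inverseˡ (+ r₀))) (ℤP.+-identityʳ r))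

proposition10 : (k : ℕ) → 1 ≤ k →
    (𝒜 : List (G k)) → Unique 𝒜 →
    (∀ a → a ∈ 𝒜 → (-G a) ∈ 𝒜) →
    0G ∉ 𝒜 →
    (∀ (x : G k) → Σ (Fin (length 𝒜) → ℤ) (λ c → lincomb 𝒜 c ≡ x)) →
    (D : ℕ) → 1 ≤ D →
    (∀ x → x ∈ 𝒜 → Cayley.Secondary 𝒜 x → ¬ Cayley.GeodUnique 𝒜 (D ·G x) D) →
    (r : ℤ) → (φ : G k → G k) → Cayley.IsBallAut 𝒜 r φ →
    (v : G k) →
    Cayley.InBall 𝒜 (r ℤ.- + (2 ⊔ D ⊔ (2 * ‖ 𝒜 ‖L + 1))) v →
    (a : G k) → a ∈ 𝒜 → Cayley.Secondary 𝒜 a →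
    Cayley.Secondary 𝒜 (φ (v +G a) -G φ v)
proposition10 _ _ 𝒜 𝒜-unique _ _ _ D 1≤D choiceD r φ A v (n , (pos , _) , n≤) a a∈ a-secondary =
  secondary-step A D 1≤D choiceD (pathCount>0⇒reach pos) depth a∈ a-secondary
  where
  open Geodesics 𝒜 𝒜-unique
  open Ball r
  depth : + (n + D) ℤ.≤ r
  depth = depth-bound r n D _ (ℕP.m≤n⇒m≤n⊔o _ (ℕP.m≤n⊔m 2 D)) n≤
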